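{- Let $G$ be a finite group of order $n$. Then (i) $\operatorname{sdim}(\mathcal{P}_E(G))=n-1$ if and only if $G$ is cyclic; (ii) if $G$ is a non-cyclic $\mathcal{P}$-group, then $\operatorname{sdim}(\mathcal{P}_E(G))=n-2$.
   Context: The enhanced power graph $\mathcal{P}_E(G)$ has vertex set $G$, two distinct vertices $x,y$ adjacent iff $\langle x,y\rangle$ is cyclic. A $\mathcal{P}$-group is a finite group in which every nontrivial element has prime order. For a graph $\Gamma$ and vertices $x,y,z$, $z$ strongly resolves $x$ and $y$ if there is a shortest path from $z$ to $x$ containing $y$ or a shortest path from $z$ to $y$ containing $x$; a strong resolving set is a vertex set $S$ such that every pair of distinct vertices is strongly resolved by some vertex of $S$; $\operatorname{sdim}(\Gamma)$ is the minimum size of a strong resolving set. -}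

module Defs where

open import Data.Nat using (ℕ; zero; suc; _≤_; _<_)
open import Data.Integer using (ℤ; +_; -[1+_])
open import Data.Fin using (Fin)
open import Data.Fin.Subset using (Subset; _∈_; ∣_∣)
open import Data.Nat.Primality using (Prime)
open import Data.Product using (Σ; ∃; ∃-syntax; _×_)
open import Data.Sum using (_⊎_)
open import Relation.Nullary using (¬_)
open import Relation.Binary.PropositionalEquality using (_≡_; _≢_)
open import Algebra.Core using (Op₁; Op₂)
open import Algebra.Structures using (IsGroup)

-- A finite group of order n: a group structure on the n-element set Fin n
-- (every finite group of order n is isomorphic to one of these).
record FinGroup (n : ℕ) : Set where
  infixl 7 _∙_
  field
    _∙_     : Op₂ (Fin n)
    ε       : Fin n
    _⁻¹     : Op₁ (Fin n)
    isGroup : IsGroup _≡_ _∙_ ε _⁻¹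

module _ {n : ℕ} (G : FinGroup n) where
  open FinGroup G

  pow : Fin n → ℕ → Fin n
  pow x zero    = ε
  pow x (suc k) = x ∙ pow x k

  zpow : Fin n → ℤ → Fin n
  zpow x (+ k)      = pow x k
  zpow x -[1+ k ]   = (pow x (suc k)) ⁻¹

  data Gen (x y : Fin n) : Fin n → Set where
    gen-x   : Gen x y x
    gen-y   : Gen x y y
    gen-ε   : Gen x y ε
    gen-∙   : ∀ {a b} → Gen x y a → Gen x y b → Gen x y (a ∙ b)
    gen-inv : ∀ {a} → Gen x y a → Gen x y (a ⁻¹)

  GenCyclic : Fin n → Fin n → Set
  GenCyclic x y = ∃[ z ] (Gen x y z × (∀ w → Gen x y w → ∃[ k ] w ≡ zpow z k))

  IsCyclic : Set
  IsCyclic = ∃[ g ] (∀ x → ∃[ k ] x ≡ zpow g k)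

  HasOrder : Fin n → ℕ → Set
  HasOrder x k = 0 < k × pow x k ≡ ε × (∀ m → 0 < m → pow x m ≡ ε → k ≤ m)

  IsPGroup : Set
  IsPGroup = ∀ x → x ≢ ε → ∃[ k ] (HasOrder x k × Prime k)

  Adj : Fin n → Fin n → Set
  Adj x y = x ≢ y × GenCyclic x y

  data Walk : Fin n → Fin n → ℕ → Set where
    [] : ∀ {a} → Walk a a 0
    _∷_ : ∀ {a b c l} → Adj a b → Walk b c l → Walk a c (suc l)

  data OnWalk (v : Fin n) : ∀ {a b l} → Walk a b l → Set where
    here-[] : OnWalk v ([] {v})
    here-∷  : ∀ {b c l} (e : Adj v b) (w : Walk b c l) → OnWalk v (e ∷ w)
    there   : ∀ {a b c l} (e : Adj a b) {w : Walk b c l} → OnWalk v w → OnWalk v (e ∷ w)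

  IsShortest : ∀ {a b l} → Walk a b l → Set
  IsShortest {a} {b} {l} _ = ∀ l' → Walk a b l' → l ≤ l'

  StronglyResolves : Fin n → Fin n → Fin n → Set
  StronglyResolves z x y =
      (∃[ l ] Σ (Walk z x l) (λ w → IsShortest w × OnWalk y w))
    ⊎ (∃[ l ] Σ (Walk z y l) (λ w → IsShortest w × OnWalk x w))

  IsStrongResolvingSet : Subset n → Set
  IsStrongResolvingSet S =
    ∀ x y → x ≢ y → ∃[ z ] (z ∈ S × StronglyResolves z x y)

  SDimIs : ℕ → Set
  SDimIs k = (∃[ S ] (IsStrongResolvingSet S × ∣ S ∣ ≡ k))
           × (∀ S → IsStrongResolvingSet S → k ≤ ∣ S ∣)

-- The identity ε is adjacent to every vertex of 𝒫_E(G), so shortest paths have length at most 2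
-- and a vertex z ∉ {x, y} strongly resolves x and y only if one of them is the middle vertex of
-- an induced path z – m – w whose end w is the other.  When G is cyclic the graph is complete, so
-- only x and y resolve {x, y}; when G is a 𝒫-group adjacency is transitive on nontrivial elements
-- (a nontrivial power of an element of prime order generates it), so the same holds for
-- nontrivial x and y.  Hence a strong resolving set misses at most one vertex, respectively at
-- most one nontrivial vertex besides ε.  Conversely G ∖ {ε} always resolves, and if ⟨x, y⟩ is
-- not cyclic then so does G ∖ {ε, x}, because y resolves ε and x through the path y – ε – x.
-- Since G is cyclic exactly when every ⟨x, y⟩ is, sdim = n − 1 forces G to be cyclic.
module Submission where

open import Defs
open import Data.Nat using (ℕ; _∸_)
open import Data.Product using (_×_)
open import Relation.Nullary using (¬_)
open import Function.Bundles using (_⇔_; mk⇔)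

open import Algebra.Bundles using (Group)
open import Algebra.Structures using (IsGroup)
import Algebra.Properties.Group as GroupProperties
open import Data.Nat using (zero; suc; _+_; _*_; _≤_; _<_; _%_; _/_; NonZero; ≢-nonZero; s≤s; z≤n)
open import Data.Nat.Properties
  using (+-comm; +-suc; *-comm; *-zeroʳ; *-suc; n≤1+n; n<1+n; m≤n+m; m≤n+m∸n; m≤n+o⇒m∸n≤o; ≤-trans;
         ≤-refl; ≤-reflexive; <-≤-trans; <⇒≱; ∸-monoʳ-<; +-monoʳ-≤; m≤n⇒∃[o]m+o≡n; module ≤-Reasoning)
open import Data.Nat.DivMod using (m≡m%n+[m/n]*n; m%n<n)
open import Data.Nat.Solver using (module +-*-Solver)
open +-*-Solver using (solve; _:=_; _:+_; _:*_; con)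
import Data.Nat.Divisibility as ℕ
open import Data.Nat.GCD using (gcd-GCD; gcd[m,n]∣m; gcd[m,n]∣n; module Bézout)
open import Data.Nat.Primality using (Prime; prime⇒nonZero)
open import Data.Nat.Coprimality using (Coprime; coprime-Bézout; prime⇒coprime)
open import Data.Fin using (Fin; toℕ; fromℕ<; _≟_)
open import Data.Fin.Properties using (pigeonhole; toℕ≤pred[n]; toℕ-fromℕ<; any?; all?; ¬∀⟶∃¬)
open import Data.Fin.Subset using (Subset; _∈_; _∉_; _⊆_; ∣_∣; ⁅_⁆; _∪_; ∁; ⊥)
open import Data.Fin.Subset.Properties
  using (_∈?_; ∣p∣≤n; p⊆q⇒∣p∣≤∣q∣; ∣∁p∣≡n∸∣p∣; ∣⁅x⁆∣≡1; ∣⊥∣≡0; ∪-identityˡ; ∪-identityʳ;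
         x∈∁p⇒x∉p; x∉p⇒x∈∁p; x∉∁p⇒x∈p; x∈⁅x⁆; x∈⁅y⁆⇒x≡y; x∉⁅y⁆⇒x≢y; x∈p∪q⁺; x∈p∪q⁻)
open import Data.Bool using (true; false)
import Data.Integer as ℤ
open import Data.Vec using ([]; _∷_)
open import Data.List using (List; []; _∷_; allFin)
open import Data.List.Relation.Unary.All as All using (All; []; _∷_)
open import Data.List.Membership.Propositional.Properties using (∈-allFin)
open import Data.Product using (Σ; ∃; ∃₂; ∃-syntax; _,_; proj₂)
open import Data.Sum as Sum using (_⊎_; inj₁; inj₂; [_,_]′; swap)
open import Function using (_∘_)
open import Relation.Nullary using (Dec; yes; no; contradiction)
open import Relation.Nullary.Decidable using (map′; _×-dec_; ¬?)
open import Relation.Binary.PropositionalEquality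

∣p∪q∣≤∣p∣+∣q∣ : ∀ {m} (p q : Subset m) → ∣ p ∪ q ∣ ≤ ∣ p ∣ + ∣ q ∣
∣p∪q∣≤∣p∣+∣q∣ []          []          = z≤n
∣p∪q∣≤∣p∣+∣q∣ (true ∷ p)  (false ∷ q) = s≤s (∣p∪q∣≤∣p∣+∣q∣ p q)
∣p∪q∣≤∣p∣+∣q∣ (true ∷ p)  (true ∷ q)  =
  s≤s (≤-trans (∣p∪q∣≤∣p∣+∣q∣ p q) (≤-trans (n≤1+n _) (≤-reflexive (sym (+-suc ∣ p ∣ ∣ q ∣)))))
∣p∪q∣≤∣p∣+∣q∣ (false ∷ p) (true ∷ q)  = ≤-trans (s≤s (∣p∪q∣≤∣p∣+∣q∣ p q)) (≤-reflexive (sym (+-suc ∣ p ∣ ∣ q ∣)))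
∣p∪q∣≤∣p∣+∣q∣ (false ∷ p) (false ∷ q) = ∣p∪q∣≤∣p∣+∣q∣ p q

∣⁅x⁆∪⁅y⁆∣≡2 : ∀ {m} {x y : Fin m} → x ≢ y → ∣ ⁅ x ⁆ ∪ ⁅ y ⁆ ∣ ≡ 2
∣⁅x⁆∪⁅y⁆∣≡2 {x = Fin.zero}  {Fin.zero}  x≢y = contradiction refl x≢y
∣⁅x⁆∪⁅y⁆∣≡2 {x = Fin.zero}  {Fin.suc y} _   = cong suc (trans (cong ∣_∣ (∪-identityˡ ⁅ y ⁆)) (∣⁅x⁆∣≡1 y))
∣⁅x⁆∪⁅y⁆∣≡2 {x = Fin.suc x} {Fin.zero}  _   = cong suc (trans (cong ∣_∣ (∪-identityʳ ⁅ x ⁆)) (∣⁅x⁆∣≡1 x))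
∣⁅x⁆∪⁅y⁆∣≡2 {x = Fin.suc x} {Fin.suc y} x≢y = ∣⁅x⁆∪⁅y⁆∣≡2 (x≢y ∘ cong Fin.suc)

∣∁⁅x⁆∣≡n∸1 : ∀ {m} (x : Fin m) → ∣ ∁ ⁅ x ⁆ ∣ ≡ m ∸ 1
∣∁⁅x⁆∣≡n∸1 {m} x = trans (∣∁p∣≡n∸∣p∣ ⁅ x ⁆) (cong (m ∸_) (∣⁅x⁆∣≡1 x))

∣∁[⁅x⁆∪⁅y⁆]∣≡n∸2 : ∀ {m} {x y : Fin m} → x ≢ y → ∣ ∁ (⁅ x ⁆ ∪ ⁅ y ⁆) ∣ ≡ m ∸ 2
∣∁[⁅x⁆∪⁅y⁆]∣≡n∸2 {m} {x} {y} x≢y = trans (∣∁p∣≡n∸∣p∣ (⁅ x ⁆ ∪ ⁅ y ⁆)) (cong (m ∸_) (∣⁅x⁆∪⁅y⁆∣≡2 x≢y))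

x≢y⇒2≤n : ∀ {m} {x y : Fin m} → x ≢ y → 2 ≤ m
x≢y⇒2≤n {x = x} {y} x≢y = subst (_≤ _) (∣⁅x⁆∪⁅y⁆∣≡2 x≢y) (∣p∣≤n (⁅ x ⁆ ∪ ⁅ y ⁆))

n∸[1+∣A∣]≤∣S∣ : ∀ {m} (S A : Subset m) →
  (∀ {x y} → x ∉ S → y ∉ S → x ∉ A → y ∉ A → x ≡ y) → m ∸ suc ∣ A ∣ ≤ ∣ S ∣
n∸[1+∣A∣]≤∣S∣ {m} S A unique = m≤n+o⇒m∸n≤o m (suc ∣ A ∣) (begin
    m                    ≤⟨ m≤n+m∸n m ∣ S ∣ ⟩
    ∣ S ∣ + (m ∸ ∣ S ∣)  ≡⟨ cong (∣ S ∣ +_) (∣∁p∣≡n∸∣p∣ S) ⟨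
    ∣ S ∣ + ∣ ∁ S ∣      ≤⟨ +-monoʳ-≤ ∣ S ∣ ∣∁S∣≤1+∣A∣ ⟩
    ∣ S ∣ + suc ∣ A ∣    ≡⟨ +-comm ∣ S ∣ _ ⟩
    suc ∣ A ∣ + ∣ S ∣    ∎)
  where
    open ≤-Reasoning
    ∣∁S∣≤1+∣A∣ : ∣ ∁ S ∣ ≤ suc ∣ A ∣
    ∣∁S∣≤1+∣A∣ with any? (λ u → ¬? (u ∈? S) ×-dec ¬? (u ∈? A))
    ... | yes (u , u∉S , u∉A) = begin
        ∣ ∁ S ∣          ≤⟨ p⊆q⇒∣p∣≤∣q∣ ∁S⊆A∪⁅u⁆ ⟩
        ∣ A ∪ ⁅ u ⁆ ∣    ≤⟨ ∣p∪q∣≤∣p∣+∣q∣ A ⁅ u ⁆ ⟩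
        ∣ A ∣ + ∣ ⁅ u ⁆ ∣ ≡⟨ cong (∣ A ∣ +_) (∣⁅x⁆∣≡1 u) ⟩
        ∣ A ∣ + 1         ≡⟨ +-comm ∣ A ∣ 1 ⟩
        suc ∣ A ∣         ∎
      where
        ∁S⊆A∪⁅u⁆ : ∁ S ⊆ A ∪ ⁅ u ⁆
        ∁S⊆A∪⁅u⁆ {x} x∈∁S with x ∈? A
        ... | yes x∈A = x∈p∪q⁺ (inj₁ x∈A)
        ... | no x∉A  = x∈p∪q⁺ (inj₂ (subst (_∈ ⁅ u ⁆) (sym (unique (x∈∁p⇒x∉p x∈∁S) u∉S x∉A u∉A)) (x∈⁅x⁆ u)))
    ... | no ∄u = ≤-trans (p⊆q⇒∣p∣≤∣q∣ ∁S⊆A) (n≤1+n ∣ A ∣)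
      where
        ∁S⊆A : ∁ S ⊆ A
        ∁S⊆A {x} x∈∁S with x ∈? A
        ... | yes x∈A = x∈A
        ... | no x∉A  = contradiction (x , x∈∁p⇒x∉p x∈∁S , x∉A) ∄u

module _ {n : ℕ} (G : FinGroup n) where
  open FinGroup G
  open IsGroup isGroup using (assoc; identityˡ; identityʳ)

  group : Group _ _
  group = record { isGroup = isGroup }

  open GroupProperties group using (identityˡ-unique; inverseˡ-unique; x≈z//y)

  infixr 8 _^_
  _^_ : Fin n → ℕ → Fin n
  _^_ = pow G

  ^-+ : ∀ x a b → x ^ (a + b) ≡ x ^ a ∙ x ^ b
  ^-+ x zero    b = sym (identityˡ _)
  ^-+ x (suc a) b = trans (cong (x ∙_) (^-+ x a b)) (sym (assoc _ _ _))

  ^-*-assoc : ∀ x a b → (x ^ a) ^ b ≡ x ^ (a * b)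
  ^-*-assoc x a zero    = cong (x ^_) (sym (*-zeroʳ a))
  ^-*-assoc x a (suc b) = begin
    x ^ a ∙ (x ^ a) ^ b  ≡⟨ cong (x ^ a ∙_) (^-*-assoc x a b) ⟩
    x ^ a ∙ x ^ (a * b)  ≡⟨ ^-+ x a (a * b) ⟨
    x ^ (a + a * b)      ≡⟨ cong (x ^_) (*-suc a b) ⟨
    x ^ (a * suc b)      ∎
    where open ≡-Reasoning

  ^-*-assoc′ : ∀ x a b → (x ^ a) ^ b ≡ x ^ (b * a)
  ^-*-assoc′ x a b = trans (^-*-assoc x a b) (cong (x ^_) (*-comm a b))

  ε^ : ∀ b → ε ^ b ≡ ε
  ε^ zero    = refl
  ε^ (suc b) = trans (identityˡ _) (ε^ b)

  ^-order-multiple : ∀ {x p} → x ^ p ≡ ε → ∀ m → x ^ (m * p) ≡ ε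
  ^-order-multiple {x} {p} xᵖ≡ε m = begin
    x ^ (m * p)  ≡⟨ ^-*-assoc′ x p m ⟨
    (x ^ p) ^ m  ≡⟨ cong (_^ m) xᵖ≡ε ⟩
    ε ^ m        ≡⟨ ε^ m ⟩
    ε            ∎
    where open ≡-Reasoning

  ^-% : ∀ x k p .{{_ : NonZero p}} → x ^ p ≡ ε → x ^ k ≡ x ^ (k % p)
  ^-% x k p xᵖ≡ε = begin
    x ^ k                          ≡⟨ cong (x ^_) (m≡m%n+[m/n]*n k p) ⟩
    x ^ (k % p + k / p * p)        ≡⟨ ^-+ x (k % p) (k / p * p) ⟩
    x ^ (k % p) ∙ x ^ (k / p * p)  ≡⟨ cong (x ^ (k % p) ∙_) (^-order-multiple xᵖ≡ε (k / p)) ⟩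
    x ^ (k % p) ∙ ε                ≡⟨ identityʳ _ ⟩
    x ^ (k % p)                    ∎
    where open ≡-Reasoning

  ^-⁻¹ : ∀ {x q} → x ^ suc q ≡ ε → ∀ a → (x ^ a) ⁻¹ ≡ x ^ (a * q)
  ^-⁻¹ {x} {q} xᵖ≡ε a = sym (inverseˡ-unique _ _ (begin
    x ^ (a * q) ∙ x ^ a  ≡⟨ ^-+ x (a * q) a ⟨
    x ^ (a * q + a)      ≡⟨ cong (x ^_) (trans (+-comm (a * q) a) (sym (*-suc a q))) ⟩
    x ^ (a * suc q)      ≡⟨ ^-order-multiple xᵖ≡ε a ⟩
    ε                    ∎))
    where open ≡-Reasoning

  period : ∀ x → ∃[ q ] (q < n × x ^ suc q ≡ ε)
  period x with pigeonhole (n<1+n n) (λ i → x ^ toℕ i)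
  ... | i , j , i<j , xⁱ≡xʲ with m≤n⇒∃[o]m+o≡n i<j
  ... | q , 1+i+q≡j = q , q<n , identityˡ-unique _ _ (begin
      x ^ suc q ∙ x ^ toℕ i  ≡⟨ ^-+ x (suc q) (toℕ i) ⟨
      x ^ (suc q + toℕ i)    ≡⟨ cong (x ^_) (trans (cong suc (+-comm q (toℕ i))) 1+i+q≡j) ⟩
      x ^ toℕ j              ≡⟨ xⁱ≡xʲ ⟨
      x ^ toℕ i              ∎)
    where
      open ≡-Reasoning
      q<n : q < n
      q<n = ≤-trans (s≤s (m≤n+m q (toℕ i))) (≤-trans (≤-reflexive 1+i+q≡j) (toℕ≤pred[n] j))

  ^-reduce : ∀ x k → ∃ λ (r : Fin n) → x ^ k ≡ x ^ toℕ r
  ^-reduce x k with period x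
  ... | q , q<n , xᵖ≡ε =
    fromℕ< k%p<n , trans (^-% x k (suc q) xᵖ≡ε) (cong (x ^_) (sym (toℕ-fromℕ< k%p<n)))
    where k%p<n = <-≤-trans (m%n<n k (suc q)) q<n

  infix 4 _∈⟨_⟩ _∈⟨_⟩?
  _∈⟨_⟩ : Fin n → Fin n → Set
  w ∈⟨ z ⟩ = ∃[ k ] w ≡ z ^ k

  ∈⟨⟩-refl : ∀ z → z ∈⟨ z ⟩
  ∈⟨⟩-refl z = 1 , sym (identityʳ z)

  ε∈⟨⟩ : ∀ z → ε ∈⟨ z ⟩
  ε∈⟨⟩ z = 0 , refl

  ∈⟨ε⟩⇒≡ε : ∀ {w} → w ∈⟨ ε ⟩ → w ≡ ε
  ∈⟨ε⟩⇒≡ε (k , w≡εᵏ) = trans w≡εᵏ (ε^ k)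

  ∈⟨⟩-trans : ∀ {z c w} → c ∈⟨ z ⟩ → w ∈⟨ c ⟩ → w ∈⟨ z ⟩
  ∈⟨⟩-trans {z} (a , refl) (b , refl) = a * b , ^-*-assoc z a b

  ∈⟨⟩-⁻¹ : ∀ {z w} → w ∈⟨ z ⟩ → w ⁻¹ ∈⟨ z ⟩
  ∈⟨⟩-⁻¹ {z} (a , refl) with period z
  ... | q , _ , zᵖ≡ε = a * q , ^-⁻¹ zᵖ≡ε a

  zpow⇒∈⟨⟩ : ∀ {z w} → ∃[ k ] w ≡ zpow G z k → w ∈⟨ z ⟩
  zpow⇒∈⟨⟩ (ℤ.+ k , w≡zᵏ)    = k , w≡zᵏ
  zpow⇒∈⟨⟩ (ℤ.-[1+ k ] , refl) = ∈⟨⟩-⁻¹ (suc k , refl)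

  ∈⟨⟩⇒zpow : ∀ {z w} → w ∈⟨ z ⟩ → ∃[ k ] w ≡ zpow G z k
  ∈⟨⟩⇒zpow (k , w≡zᵏ) = ℤ.+ k , w≡zᵏ

  _∈⟨_⟩? : ∀ w z → Dec (w ∈⟨ z ⟩)
  w ∈⟨ z ⟩? = map′ (λ (r , w≡zʳ) → toℕ r , w≡zʳ)
                   (λ (k , w≡zᵏ) → let r , zᵏ≡zʳ = ^-reduce z k in r , trans w≡zᵏ zᵏ≡zʳ)
                   (any? λ r → w ≟ z ^ toℕ r)

  gen-swap : ∀ {a b w} → Gen G a b w → Gen G b a w
  gen-swap gen-x         = gen-y
  gen-swap gen-y         = gen-x
  gen-swap gen-ε         = gen-ε
  gen-swap (gen-∙ g h)   = gen-∙ (gen-swap g) (gen-swap h)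
  gen-swap (gen-inv g)   = gen-inv (gen-swap g)

  gen-^ˡ : ∀ {a b} k → Gen G a b (a ^ k)
  gen-^ˡ zero    = gen-ε
  gen-^ˡ (suc k) = gen-∙ gen-x (gen-^ˡ k)

  gen-^ʳ : ∀ {a b} k → Gen G a b (b ^ k)
  gen-^ʳ k = gen-swap (gen-^ˡ k)

  gen-exponents : ∀ z α β {w} → Gen G (z ^ α) (z ^ β) w → ∃₂ λ i j → w ≡ z ^ (α * i + β * j)
  gen-exponents z α β gen-x = 1 , 0 , cong (z ^_) (solve 2 (λ α β → α := α :* con 1 :+ β :* con 0) refl α β)
  gen-exponents z α β gen-y = 0 , 1 , cong (z ^_) (solve 2 (λ α β → β := α :* con 0 :+ β :* con 1) refl α β)
  gen-exponents z α β gen-ε = 0 , 0 , cong (z ^_) (solve 2 (λ α β → con 0 := α :* con 0 :+ β :* con 0) refl α β)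
  gen-exponents z α β (gen-∙ g h) with gen-exponents z α β g | gen-exponents z α β h
  ... | i , j , refl | i′ , j′ , refl = i + i′ , j + j′ ,
    trans (sym (^-+ z (α * i + β * j) (α * i′ + β * j′))) (cong (z ^_) (solve 6
      (λ α β i j i′ j′ → (α :* i :+ β :* j) :+ (α :* i′ :+ β :* j′) := α :* (i :+ i′) :+ β :* (j :+ j′))
      refl α β i j i′ j′))
  gen-exponents z α β (gen-inv g) with gen-exponents z α β g | period z
  ... | i , j , refl | q , _ , zᵖ≡ε = i * q , j * q ,
    trans (^-⁻¹ zᵖ≡ε (α * i + β * j)) (cong (z ^_) (solve 5
      (λ α β i j q → (α :* i :+ β :* j) :* q := α :* (i :* q) :+ β :* (j :* q))
      refl α β i j q))

  gen-∈⟨⟩ : ∀ {z a b w} → a ∈⟨ z ⟩ → b ∈⟨ z ⟩ → Gen G a b w → w ∈⟨ z ⟩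
  gen-∈⟨⟩ {z} (α , refl) (β , refl) g = let i , j , w≡ = gen-exponents z α β g in α * i + β * j , w≡

  gen-normal-form : ∀ {z a b w} → a ∈⟨ z ⟩ → b ∈⟨ z ⟩ → Gen G a b w → ∃₂ λ i j → w ≡ a ^ i ∙ b ^ j
  gen-normal-form {z} (α , refl) (β , refl) g with gen-exponents z α β g
  ... | i , j , w≡ = i , j , trans w≡
    (trans (^-+ z (α * i) (β * j)) (sym (cong₂ _∙_ (^-*-assoc z α i) (^-*-assoc z β j))))

  genCyclic-intro : ∀ {z a b} → a ∈⟨ z ⟩ → b ∈⟨ z ⟩ → Gen G a b z → GenCyclic G a b
  genCyclic-intro a∈ b∈ z∈ = _ , z∈ , λ _ w∈ → ∈⟨⟩⇒zpow (gen-∈⟨⟩ a∈ b∈ w∈)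

  genCyclic-elim : ∀ {a b} → GenCyclic G a b → ∃[ z ] (a ∈⟨ z ⟩ × b ∈⟨ z ⟩ × Gen G a b z)
  genCyclic-elim (z , z∈ , generates) =
    z , zpow⇒∈⟨⟩ (generates _ gen-x) , zpow⇒∈⟨⟩ (generates _ gen-y) , z∈

  genCyclic-refl : ∀ a → GenCyclic G a a
  genCyclic-refl a = genCyclic-intro (∈⟨⟩-refl a) (∈⟨⟩-refl a) gen-x

  genCyclic-sym : ∀ {a b} → GenCyclic G a b → GenCyclic G b a
  genCyclic-sym c = let _ , a∈ , b∈ , z∈ = genCyclic-elim c in genCyclic-intro b∈ a∈ (gen-swap z∈)

  genCyclic-εˡ : ∀ b → GenCyclic G ε b
  genCyclic-εˡ b = genCyclic-intro (ε∈⟨⟩ b) (∈⟨⟩-refl b) gen-y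

  genCyclic-εʳ : ∀ a → GenCyclic G a ε
  genCyclic-εʳ a = genCyclic-sym (genCyclic-εˡ a)

  -- Within a cyclic ⟨z⟩ ∋ a, b, the generator of ⟨a, b⟩ can be sought among the a^i b^j with i, j < n.
  genCyclic? : ∀ a b → Dec (GenCyclic G a b)
  genCyclic? a b = map′ sound complete
    (any? λ z → any? λ i → any? λ j → (z ≟ a ^ toℕ i ∙ b ^ toℕ j) ×-dec a ∈⟨ z ⟩? ×-dec b ∈⟨ z ⟩?)
    where
      Witness : Set
      Witness = ∃ λ z → ∃₂ λ (i j : Fin n) → z ≡ a ^ toℕ i ∙ b ^ toℕ j × a ∈⟨ z ⟩ × b ∈⟨ z ⟩

      sound : Witness → GenCyclic G a b
      sound (z , i , j , refl , a∈ , b∈) = genCyclic-intro a∈ b∈ (gen-∙ (gen-^ˡ (toℕ i)) (gen-^ʳ (toℕ j)))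

      complete : GenCyclic G a b → Witness
      complete c with genCyclic-elim c
      ... | z , a∈ , b∈ , z∈ with gen-normal-form a∈ b∈ z∈
      ... | i , j , z≡aⁱbʲ with ^-reduce a i | ^-reduce b j
      ... | i′ , aⁱ≡ | j′ , bʲ≡ = z , i′ , j′ , trans z≡aⁱbʲ (cong₂ _∙_ aⁱ≡ bʲ≡) , a∈ , b∈

  common-generator : (∀ a b → GenCyclic G a b) → (xs : List (Fin n)) → ∃[ c ] All (_∈⟨ c ⟩) xs
  common-generator adj []       = ε , []
  common-generator adj (x ∷ xs) with common-generator adj xs
  ... | c , xs⊆⟨c⟩ with genCyclic-elim (adj c x)
  ... | z , c∈ , x∈ , _ = z , x∈ ∷ All.map (∈⟨⟩-trans c∈) xs⊆⟨c⟩

  genCyclic⇒cyclic : (∀ a b → GenCyclic G a b) → IsCyclic G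
  genCyclic⇒cyclic adj with common-generator adj (allFin n)
  ... | c , G⊆⟨c⟩ = c , λ x → ∈⟨⟩⇒zpow (All.lookup G⊆⟨c⟩ (∈-allFin x))

  gen-difference : ∀ g d α β x y → d + y * β ≡ x * α → Gen G (g ^ α) (g ^ β) (g ^ d)
  gen-difference g d α β x y eq = subst (Gen G _ _) (sym gᵈ≡) (gen-∙ (gen-^ˡ x) (gen-inv (gen-^ʳ y)))
    where
      open ≡-Reasoning
      gᵈ≡ : g ^ d ≡ (g ^ α) ^ x ∙ ((g ^ β) ^ y) ⁻¹
      gᵈ≡ = x≈z//y _ _ _ (begin
        g ^ d ∙ (g ^ β) ^ y  ≡⟨ cong (g ^ d ∙_) (^-*-assoc′ g β y) ⟩
        g ^ d ∙ g ^ (y * β)  ≡⟨ ^-+ g d (y * β) ⟨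
        g ^ (d + y * β)      ≡⟨ cong (g ^_) eq ⟩
        g ^ (x * α)          ≡⟨ ^-*-assoc′ g α x ⟨
        (g ^ α) ^ x          ∎)

  gen-bézout : ∀ g {d α β} → Bézout.Identity d α β → Gen G (g ^ α) (g ^ β) (g ^ d)
  gen-bézout g {d} {α} {β} (Bézout.+- x y eq) = gen-difference g d α β x y eq
  gen-bézout g {d} {α} {β} (Bézout.-+ x y eq) = gen-swap (gen-difference g d β α y x eq)

  ∣⇒∈⟨^⟩ : ∀ g {d m} → d ℕ.∣ m → g ^ m ∈⟨ g ^ d ⟩
  ∣⇒∈⟨^⟩ g {d} (ℕ.divides q refl) = q , sym (^-*-assoc′ g d q)

  cyclic⇒genCyclic : IsCyclic G → ∀ a b → GenCyclic G a b
  cyclic⇒genCyclic (g , generates) a b with zpow⇒∈⟨⟩ (generates a) | zpow⇒∈⟨⟩ (generates b)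
  ... | α , refl | β , refl =
    genCyclic-intro (∣⇒∈⟨^⟩ g (gcd[m,n]∣m α β)) (∣⇒∈⟨^⟩ g (gcd[m,n]∣n α β))
                    (gen-bézout g (Bézout.identity (gcd-GCD α β)))

  coprime-power-generates : ∀ {c p r} → c ^ p ≡ ε → Coprime p r → c ∈⟨ c ^ r ⟩
  coprime-power-generates {c} {p} {r} cᵖ≡ε p⊥r with coprime-Bézout p⊥r
  ... | Bézout.+- x y eq = subst (_∈⟨ c ^ r ⟩) (sym c≡) (∈⟨⟩-⁻¹ (y , refl))
    where
      open ≡-Reasoning
      c≡ : c ≡ ((c ^ r) ^ y) ⁻¹
      c≡ = inverseˡ-unique _ _ (begin
        c ∙ (c ^ r) ^ y   ≡⟨ cong (c ∙_) (^-*-assoc′ c r y) ⟩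
        c ^ (1 + y * r)   ≡⟨ cong (c ^_) eq ⟩
        c ^ (x * p)       ≡⟨ ^-order-multiple cᵖ≡ε x ⟩
        ε                 ∎)
  ... | Bézout.-+ x y eq = y , (begin
        c                  ≡⟨ identityʳ c ⟨
        c ∙ ε              ≡⟨ cong (c ∙_) (^-order-multiple cᵖ≡ε x) ⟨
        c ^ (1 + x * p)    ≡⟨ cong (c ^_) eq ⟩
        c ^ (y * r)        ≡⟨ ^-*-assoc′ c r y ⟨
        (c ^ r) ^ y        ∎)
    where open ≡-Reasoning

  generated-by-nontrivial-power : ∀ {c p a} → c ^ p ≡ ε → Prime p → a ∈⟨ c ⟩ → a ≢ ε → c ∈⟨ a ⟩
  generated-by-nontrivial-power {c} {p} cᵖ≡ε p-prime (m , refl) cᵐ≢ε =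
    subst (c ∈⟨_⟩) (sym cᵐ≡cʳ) (coprime-power-generates cᵖ≡ε (prime⇒coprime p-prime r<p))
    where
      instance
        p≢0 : NonZero p
        p≢0 = prime⇒nonZero p-prime
      r = m % p
      cᵐ≡cʳ : c ^ m ≡ c ^ r
      cᵐ≡cʳ = ^-% c m p cᵖ≡ε
      instance
        r≢0 : NonZero r
        r≢0 = ≢-nonZero λ r≡0 → cᵐ≢ε (trans cᵐ≡cʳ (cong (c ^_) r≡0))
      r<p : r < p
      r<p = m%n<n m p

  genCyclic⇒∈⟨⟩ : IsPGroup G → ∀ {a b} → a ≢ ε → GenCyclic G a b → b ∈⟨ a ⟩
  genCyclic⇒∈⟨⟩ isP a≢ε c with genCyclic-elim c
  ... | z , a∈ , b∈ , _ with isP z (λ z≡ε → a≢ε (∈⟨ε⟩⇒≡ε (subst (_ ∈⟨_⟩) z≡ε a∈)))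
  ... | p , (_ , zᵖ≡ε , _) , p-prime = ∈⟨⟩-trans (generated-by-nontrivial-power zᵖ≡ε p-prime a∈ a≢ε) b∈

  genCyclic-trans : IsPGroup G → ∀ {a b c} → a ≢ ε → b ≢ ε →
                    GenCyclic G a b → GenCyclic G b c → GenCyclic G a c
  genCyclic-trans isP a≢ε b≢ε ab bc =
    genCyclic-intro (∈⟨⟩-refl _) (∈⟨⟩-trans (genCyclic⇒∈⟨⟩ isP a≢ε ab) (genCyclic⇒∈⟨⟩ isP b≢ε bc)) gen-x

  nonadjacent⇒≢εˡ : ∀ {a b} → ¬ GenCyclic G a b → a ≢ ε
  nonadjacent⇒≢εˡ {b = b} ¬ab refl = ¬ab (genCyclic-εˡ b)

  nonadjacent⇒≢εʳ : ∀ {a b} → ¬ GenCyclic G a b → b ≢ ε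
  nonadjacent⇒≢εʳ {a} ¬ab refl = ¬ab (genCyclic-εʳ a)

  nonadjacent⇒≢ : ∀ {a b} → ¬ GenCyclic G a b → a ≢ b
  nonadjacent⇒≢ {a} ¬ab refl = ¬ab (genCyclic-refl a)

  cyclic-or-nonadjacent-pair : IsCyclic G ⊎ ∃₂ λ x y → ¬ GenCyclic G x y
  cyclic-or-nonadjacent-pair with all? (λ x → all? (genCyclic? x))
  ... | yes adj = inj₁ (genCyclic⇒cyclic adj)
  ... | no ¬adj with ¬∀⟶∃¬ n _ (λ x → all? (genCyclic? x)) ¬adj
  ... | x , ¬adjx with ¬∀⟶∃¬ n _ (genCyclic? x) ¬adjx
  ... | y , ¬xy = inj₂ (x , y , ¬xy)

  via-ε : ∀ {a b} → ¬ GenCyclic G a b → Σ (Walk G a b 2) λ w → IsShortest G w × OnWalk G ε w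
  via-ε {a} {b} ¬ab = w , shortest , there _ (here-∷ _ _)
    where
      w : Walk G a b 2
      w = (nonadjacent⇒≢εˡ ¬ab , genCyclic-εʳ a) ∷ (nonadjacent⇒≢εʳ ¬ab ∘ sym , genCyclic-εˡ b) ∷ []
      shortest : IsShortest G w
      shortest zero          []              = contradiction refl (nonadjacent⇒≢ ¬ab)
      shortest (suc zero)    ((_ , ab) ∷ []) = contradiction ab ¬ab
      shortest (suc (suc l)) _               = s≤s (s≤s z≤n)

  shortest-walk : ∀ a b → ∃[ l ] (l ≤ 2 × Σ (Walk G a b l) (IsShortest G))
  shortest-walk a b with a ≟ b
  ... | yes refl = 0 , z≤n , [] , λ _ _ → z≤n
  ... | no a≢b with genCyclic? a b
  ... | yes ab = 1 , s≤s z≤n , (a≢b , ab) ∷ [] , shortest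
    where
      shortest : ∀ l → Walk G a b l → 1 ≤ l
      shortest zero    []  = contradiction refl a≢b
      shortest (suc l) _   = s≤s z≤n
  ... | no ¬ab = let w , shortest , _ = via-ε ¬ab in 2 , ≤-refl , w , shortest

  shortest⇒length≤2 : ∀ {a b l} (w : Walk G a b l) → IsShortest G w → l ≤ 2
  shortest⇒length≤2 {a} {b} _ shortest =
    let l , l≤2 , w′ , _ = shortest-walk a b in ≤-trans (shortest l w′) l≤2

  start-on-walk : ∀ {a b l} (w : Walk G a b l) → OnWalk G a w
  start-on-walk []      = here-[]
  start-on-walk (e ∷ w) = here-∷ e w

  vertex-resolves-itself : ∀ a b → StronglyResolves G a a b
  vertex-resolves-itself a b =
    let l , _ , w , shortest = shortest-walk a b in inj₂ (l , w , shortest , start-on-walk w)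

  InducedPath : Fin n → Fin n → Fin n → Set
  InducedPath z m x = GenCyclic G z m × GenCyclic G m x × ¬ GenCyclic G z x

  shortest⇒nonadjacent : ∀ {z x l} (w : Walk G z x (suc (suc l))) → IsShortest G w → ¬ GenCyclic G z x
  shortest⇒nonadjacent {z} {x} _ shortest zx with z ≟ x
  ... | yes refl = contradiction (shortest 0 []) λ ()
  ... | no z≢x   = contradiction (shortest 1 ((z≢x , zx) ∷ [])) λ { (s≤s ()) }

  interior-of-shortest : ∀ {z x y l} (w : Walk G z x l) → IsShortest G w → OnWalk G y w →
                         y ≢ z → y ≢ x → InducedPath z y x
  interior-of-shortest w shortest = go w shortest (shortest⇒length≤2 w shortest)
    where
      go : ∀ {z x y l} (w : Walk G z x l) → IsShortest G w → l ≤ 2 → OnWalk G y w →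
           y ≢ z → y ≢ x → InducedPath z y x
      go []              _  _ here-[]                     y≢z _   = contradiction refl y≢z
      go (_ ∷ [])        _  _ (here-∷ _ _)                y≢z _   = contradiction refl y≢z
      go (_ ∷ [])        _  _ (there _ here-[])           _   y≢x = contradiction refl y≢x
      go (_ ∷ _ ∷ [])    _  _ (here-∷ _ _)                y≢z _   = contradiction refl y≢z
      go (e ∷ e′ ∷ [])   sh _ (there _ (here-∷ _ _))      _   _   =
        proj₂ e , proj₂ e′ , shortest⇒nonadjacent (e ∷ e′ ∷ []) sh
      go (_ ∷ _ ∷ [])    _  _ (there _ (there _ here-[])) _   y≢x = contradiction refl y≢x
      go (_ ∷ _ ∷ _ ∷ _) _  (s≤s (s≤s ())) _

  endpoint-of-resolution : ∀ {z x y l} → ¬ InducedPath z y x → y ≢ x → (w : Walk G z x l) →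
                           IsShortest G w → OnWalk G y w → z ≡ y
  endpoint-of-resolution {z} {y = y} ¬zyx y≢x w shortest y∈w with y ≟ z
  ... | yes refl = refl
  ... | no y≢z   = contradiction (interior-of-shortest w shortest y∈w y≢z y≢x) ¬zyx

  resolver-is-endpoint : ∀ {x y} → (∀ {z} → ¬ InducedPath z y x) → (∀ {z} → ¬ InducedPath z x y) →
                         x ≢ y → ∀ {z} → StronglyResolves G z x y → z ≡ x ⊎ z ≡ y
  resolver-is-endpoint ¬zyx _    x≢y (inj₁ (_ , w , shortest , y∈w)) =
    inj₂ (endpoint-of-resolution ¬zyx (x≢y ∘ sym) w shortest y∈w)
  resolver-is-endpoint _    ¬zxy x≢y (inj₂ (_ , w , shortest , x∈w)) =
    inj₁ (endpoint-of-resolution ¬zxy x≢y w shortest x∈w)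

  lower-bound-from-endpoints : (A : Subset n) →
    (∀ {x y} → x ∉ A → y ∉ A → x ≢ y → ∀ {z} → StronglyResolves G z x y → z ≡ x ⊎ z ≡ y) →
    ∀ S → IsStrongResolvingSet G S → n ∸ suc ∣ A ∣ ≤ ∣ S ∣
  lower-bound-from-endpoints A endpoints S resolving = n∸[1+∣A∣]≤∣S∣ S A unique
    where
      unique : ∀ {x y} → x ∉ S → y ∉ S → x ∉ A → y ∉ A → x ≡ y
      unique {x} {y} x∉S y∉S x∉A y∉A with x ≟ y
      ... | yes x≡y = x≡y
      ... | no x≢y with resolving x y x≢y
      ... | z , z∈S , resolves with endpoints x∉A y∉A x≢y resolves
      ... | inj₁ refl = contradiction z∈S x∉S
      ... | inj₂ refl = contradiction z∈S y∉S

  cyclic⇒n∸1≤∣S∣ : IsCyclic G → ∀ S → IsStrongResolvingSet G S → n ∸ 1 ≤ ∣ S ∣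
  cyclic⇒n∸1≤∣S∣ cyclic S resolving = subst (λ k → n ∸ suc k ≤ ∣ S ∣) (∣⊥∣≡0 n)
    (lower-bound-from-endpoints ⊥ (λ _ _ → resolver-is-endpoint no-induced-path no-induced-path) S resolving)
    where
      no-induced-path : ∀ {z m x} → ¬ InducedPath z m x
      no-induced-path (_ , _ , ¬zx) = ¬zx (cyclic⇒genCyclic cyclic _ _)

  pgroup⇒n∸2≤∣S∣ : IsPGroup G → ∀ S → IsStrongResolvingSet G S → n ∸ 2 ≤ ∣ S ∣
  pgroup⇒n∸2≤∣S∣ isP S resolving = subst (λ k → n ∸ suc k ≤ ∣ S ∣) (∣⁅x⁆∣≡1 ε)
    (lower-bound-from-endpoints ⁅ ε ⁆ endpoints S resolving)
    where
      no-induced-path : ∀ {z m x} → m ≢ ε → ¬ InducedPath z m x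
      no-induced-path m≢ε (zm , mx , ¬zx) = ¬zx (genCyclic-trans isP (nonadjacent⇒≢εˡ ¬zx) m≢ε zm mx)
      endpoints : ∀ {x y} → x ∉ ⁅ ε ⁆ → y ∉ ⁅ ε ⁆ → x ≢ y → ∀ {z} → StronglyResolves G z x y → z ≡ x ⊎ z ≡ y
      endpoints x∉ y∉ = resolver-is-endpoint (no-induced-path (x∉⁅y⁆⇒x≢y y∉)) (no-induced-path (x∉⁅y⁆⇒x≢y x∉))

  resolving-if-outside-pairs-resolved : ∀ S →
    (∀ {a b} → a ∉ S → b ∉ S → a ≢ b → ∃[ z ] (z ∈ S × StronglyResolves G z a b)) → IsStrongResolvingSet G S
  resolving-if-outside-pairs-resolved S outside a b a≢b with a ∈? S | b ∈? S
  ... | yes a∈S | _       = a , a∈S , vertex-resolves-itself a b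
  ... | no _    | yes b∈S = b , b∈S , swap (vertex-resolves-itself b a)
  ... | no a∉S  | no b∉S  = outside a∉S b∉S a≢b

  nontrivial-resolving : IsStrongResolvingSet G (∁ ⁅ ε ⁆)
  nontrivial-resolving = resolving-if-outside-pairs-resolved _ λ a∉ b∉ → contradiction (trans (≡ε a∉) (sym (≡ε b∉)))
    where
      ≡ε : ∀ {a} → a ∉ ∁ ⁅ ε ⁆ → a ≡ ε
      ≡ε = x∈⁅y⁆⇒x≡y ε ∘ x∉∁p⇒x∈p

  nonadjacent⇒resolving : ∀ {x y} → ¬ GenCyclic G x y → IsStrongResolvingSet G (∁ (⁅ ε ⁆ ∪ ⁅ x ⁆))
  nonadjacent⇒resolving {x} {y} ¬xy = resolving-if-outside-pairs-resolved _ outside-pairs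
    where
      ε-or-x : ∀ {a} → a ∈ ⁅ ε ⁆ ∪ ⁅ x ⁆ → a ≡ ε ⊎ a ≡ x
      ε-or-x = Sum.map (x∈⁅y⁆⇒x≡y ε) (x∈⁅y⁆⇒x≡y x) ∘ x∈p∪q⁻ ⁅ ε ⁆ ⁅ x ⁆
      ¬yx : ¬ GenCyclic G y x
      ¬yx = ¬xy ∘ genCyclic-sym
      y∈S : y ∈ ∁ (⁅ ε ⁆ ∪ ⁅ x ⁆)
      y∈S = x∉p⇒x∈∁p ([ nonadjacent⇒≢εˡ ¬yx , nonadjacent⇒≢ ¬yx ]′ ∘ ε-or-x)
      y-resolves-ε-x : StronglyResolves G y ε x
      y-resolves-ε-x = let w , shortest , ε∈w = via-ε ¬yx in inj₂ (2 , w , shortest , ε∈w)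
      outside-pairs : ∀ {a b} → a ∉ ∁ (⁅ ε ⁆ ∪ ⁅ x ⁆) → b ∉ ∁ (⁅ ε ⁆ ∪ ⁅ x ⁆) → a ≢ b →
                      ∃[ z ] (z ∈ ∁ (⁅ ε ⁆ ∪ ⁅ x ⁆) × StronglyResolves G z a b)
      outside-pairs a∉ b∉ a≢b with ε-or-x (x∉∁p⇒x∈p a∉) | ε-or-x (x∉∁p⇒x∈p b∉)
      ... | inj₁ refl | inj₁ refl = contradiction refl a≢b
      ... | inj₂ refl | inj₂ refl = contradiction refl a≢b
      ... | inj₁ refl | inj₂ refl = y , y∈S , y-resolves-ε-x
      ... | inj₂ refl | inj₁ refl = y , y∈S , swap y-resolves-ε-x

corollary4p6 : (n : ℕ) (G : FinGroup n) →
    (SDimIs G (n ∸ 1) ⇔ IsCyclic G)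
    × (IsPGroup G → ¬ IsCyclic G → SDimIs G (n ∸ 2))
corollary4p6 n G = mk⇔ sdim⇒cyclic cyclic⇒sdim , pgroup⇒sdim
  where
    open FinGroup G using (ε)

    sdim⇒cyclic : SDimIs G (n ∸ 1) → IsCyclic G
    sdim⇒cyclic (_ , minimal) with cyclic-or-nonadjacent-pair G
    ... | inj₁ cyclic = cyclic
    ... | inj₂ (x , _ , ¬xy) = contradiction
      (subst (n ∸ 1 ≤_) (∣∁[⁅x⁆∪⁅y⁆]∣≡n∸2 ε≢x) (minimal _ (nonadjacent⇒resolving G ¬xy)))
      (<⇒≱ (∸-monoʳ-< (n<1+n 1) (x≢y⇒2≤n ε≢x)))
      where
        ε≢x : ε ≢ x
        ε≢x = nonadjacent⇒≢εˡ G ¬xy ∘ sym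

    cyclic⇒sdim : IsCyclic G → SDimIs G (n ∸ 1)
    cyclic⇒sdim cyclic = (_ , nontrivial-resolving G , ∣∁⁅x⁆∣≡n∸1 ε) , cyclic⇒n∸1≤∣S∣ G cyclic

    pgroup⇒sdim : IsPGroup G → ¬ IsCyclic G → SDimIs G (n ∸ 2)
    pgroup⇒sdim isP ¬cyclic with cyclic-or-nonadjacent-pair G
    ... | inj₁ cyclic = contradiction cyclic ¬cyclic
    ... | inj₂ (x , _ , ¬xy) =
      (_ , nonadjacent⇒resolving G ¬xy , ∣∁[⁅x⁆∪⁅y⁆]∣≡n∸2 (nonadjacent⇒≢εˡ G ¬xy ∘ sym)) , pgroup⇒n∸2≤∣S∣ G isP
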